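{- Let $t,\alpha$ be positive integers and $p$ a prime. Let $\mathcal F\subset\{0,1\}^n$ be a full-support $k$-wise $\ell$-divisible family, for positive integers $k,\ell$ with $p^\alpha\mid\ell$ and $k\ge t\phi(p^\alpha)$ ($\phi$ Euler's totient function). Let $V$ be the $\mathbb F_p$-span of $\mathcal F$, let $m=\dim\operatorname{St}(V^{\langle t\rangle})$ and let $V^{\langle t\rangle}=C_1\oplus\cdots\oplus C_m$ be the unique decomposition into non-zero codes whose supports are non-empty and partition $[n]$, with no $C_i$ decomposing further into a direct sum of more than one code with disjoint non-empty supports. Let $I=\{i\in[m]:\dim C_i\ge2\}$ and $S=\bigcup_{i\in I}\operatorname{supp}(C_i)$. Then every $j\in[n]\setminus S$ belongs to an atom of $\mathcal F$ of cardinality divisible by $p^\alpha$.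
   Context: Members of $\mathcal F$ are identified with subsets of $[n]$; full support means their union is $[n]$; $k$-wise $\ell$-divisible means $|A_1\cap\cdots\cap A_k|$ is divisible by $\ell$ for all (not necessarily distinct) $A_1,\dots,A_k\in\mathcal F$. For subspaces $C,D\subset\mathbb F_p^n$, $CD$ is the span of coordinatewise products; $V^{\langle 1\rangle}=V$, $V^{\langle i\rangle}=V^{\langle i-1\rangle}V$; $\operatorname{St}(C)=\{x: x*C\subset C\}$; the support of a code is the set of coordinates on which some of its vectors is non-zero. An atom of $\mathcal F$ is a non-empty subset $A\subset[n]$ such that (i) for every $F\in\mathcal F$, either $A\subset F$ or $A\cap F=\varnothing$, and (ii) for every $B\supsetneq A$ there is $F\in\mathcal F$ with $\varnothing\subsetneq F\cap B\subsetneq B$. -}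

module Defs where

open import Level using (0ℓ)
open import Data.Nat as ℕ using (ℕ; zero; suc; NonZero; _∸_)
open import Data.Nat.DivMod using (_mod_)
open import Data.Nat.Coprimality using (coprime?)
open import Data.Fin as Fin using (Fin; toℕ)
open import Data.Fin.Subset as Sub using (Subset; inside; outside; ⋂)
open import Data.Vec as Vec using (Vec; zipWith; replicate; lookup)
open import Data.List as List using (List; filter; length; tabulate)
open import Data.Product using (Σ; ∃; ∃-syntax; _×_; _,_)
open import Data.Sum using (_⊎_)
open import Relation.Nullary using (¬_)
open import Relation.Binary.PropositionalEquality using (_≡_; _≢_)

totient : ℕ → ℕ
totient m = length (filter (λ i → coprime? i m) (List.map suc (List.upTo m)))

module _ (p : ℕ) .{{_ : NonZero p}} where

  𝔽 : Set
  𝔽 = Fin p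

  0F 1F : 𝔽
  0F = 0 mod p
  1F = 1 mod p

  _+F_ _*F_ : 𝔽 → 𝔽 → 𝔽
  a +F b = (toℕ a ℕ.+ toℕ b) mod p
  a *F b = (toℕ a ℕ.* toℕ b) mod p

  Vecp : ℕ → Set
  Vecp n = Vec 𝔽 n

  Code : ℕ → Set₁
  Code n = Vecp n → Set

  module _ {n : ℕ} where

    0V : Vecp n
    0V = replicate n 0F

    _+V_ : Vecp n → Vecp n → Vecp n
    _+V_ = zipWith _+F_

    _·V_ : 𝔽 → Vecp n → Vecp n
    a ·V x = Vec.map (a *F_) x

    _*V_ : Vecp n → Vecp n → Vecp n
    _*V_ = zipWith _*F_

    χ : Subset n → Vecp n
    χ A = Vec.map (λ { inside → 1F ; outside → 0F }) A

    data Span (G : Code n) : Code n where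
      span-0   : Span G 0V
      span-gen : ∀ {x} → G x → Span G x
      span-+   : ∀ {x y} → Span G x → Span G y → Span G (x +V y)
      span-·   : ∀ {x} (a : 𝔽) → Span G x → Span G (a ·V x)

    record IsSubspace (C : Code n) : Set where
      field
        has-0  : C 0V
        has-+  : ∀ {x y} → C x → C y → C (x +V y)
        has-·  : ∀ {x} (a : 𝔽) → C x → C (a ·V x)

    _·C_ : Code n → Code n → Code n
    C ·C D = Span (λ z → ∃[ x ] ∃[ y ] (C x × D y × z ≡ x *V y))

    -- V^⟨i+1⟩ : powC V i is V^⟨i+1⟩ (so V^⟨1⟩ = V, V^⟨i⟩ = V^⟨i-1⟩ V)
    powC : Code n → ℕ → Code n
    powC V zero    = V
    powC V (suc i) = powC V i ·C V

    _^⟨_⟩ : Code n → ℕ → Code n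
    V ^⟨ t ⟩ = powC V (t ∸ 1)

    _∈supp_ : Fin n → Code n → Set
    j ∈supp C = ∃[ x ] (C x × lookup x j ≢ 0F)

    sumV : {m : ℕ} → (Fin m → Vecp n) → Vecp n
    sumV {zero}  c = 0V
    sumV {suc m} c = c Fin.zero +V sumV (λ i → c (Fin.suc i))

    record IsSuppDecomp (W : Code n) (r : ℕ) (D : Fin r → Code n) : Set where
      field
        subspace  : ∀ i → IsSubspace (D i)
        nonempty  : ∀ i → ∃[ j ] (j ∈supp D i)
        disjoint  : ∀ i i' j → j ∈supp D i → j ∈supp D i' → i ≡ i'
        sum-eq    : ∀ w → W w → ∃[ c ] ((∀ i → D i (c i)) × w ≡ sumV c)
        sum-in    : ∀ (c : Fin r → Vecp n) → (∀ i → D i (c i)) → W (sumV c)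

    Indecomposable : Code n → Set₁
    Indecomposable C = ∀ r (D : Fin r → Code n) → IsSuppDecomp C r D → r ℕ.≤ 1

    record IsIndecDecomp (W : Code n) (m : ℕ) (C : Fin m → Code n) : Set₁ where
      field
        decomp  : IsSuppDecomp W m C
        covers  : ∀ j → ∃[ i ] (j ∈supp C i)
        indec   : ∀ i → Indecomposable (C i)

    DimGe2 : Code n → Set
    DimGe2 C = ∃[ x ] ∃[ y ] (C x × C y ×
                 (∀ a b → (a ·V x) +V (b ·V y) ≡ 0V → a ≡ 0F × b ≡ 0F))

module _ {n : ℕ} where

  Family : Set₁
  Family = Subset n → Set

  FullSupport : Family → Set
  FullSupport ℱ = ∀ j → ∃[ F ] (ℱ F × j Sub.∈ F)

  KWiseDivisible : ℕ → ℕ → Family → Set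
  KWiseDivisible k ℓ ℱ =
    ∀ (A : Fin k → Subset n) → (∀ i → ℱ (A i)) →
      ℓ Data.Nat.Divisibility.∣ Sub.∣ ⋂ (tabulate A) ∣
    where import Data.Nat.Divisibility

  IsAtom : Family → Subset n → Set
  IsAtom ℱ A =
    Sub.Nonempty A ×
    (∀ F → ℱ F → (A Sub.⊆ F) ⊎ Sub.Empty (A Sub.∩ F)) ×
    (∀ B → A Sub.⊂ B → ∃[ F ] (ℱ F × Sub.Nonempty (F Sub.∩ B) × (F Sub.∩ B) Sub.⊂ B))

-- Pick i with j ∈ supp C_i and F ∈ ℱ with j ∈ F. The C_i-component of χ_F agrees with χ_F on
-- supp C_i and vanishes elsewhere, so it is χ_A for some A ∋ j; this A is the atom.
-- Since dim C_i ≤ 1, the C_i-component of any χ_G (G ∈ ℱ) is a multiple of χ_A, so G contains A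
-- or misses it. Since χ_A ∈ V^⟨t⟩ and two coordinates that no member of ℱ separates agree on all
-- of V^⟨t⟩, every r ∉ A is separated from j by a member of ℱ, which gives maximality.
-- Finally χ_A lifts to a function W : [n] → ℕ that is a polynomial of degree ≤ t in the
-- indicators of members of ℱ. Then W^(p^(α-1)) has degree ≤ t p^(α-1) ≤ t φ(p^α) ≤ k, so by k-wise
-- divisibility ℓ divides its sum over [n]; and W ≡ χ_A (mod p) gives W^(p^(α-1)) ≡ χ_A (mod p^α)
-- coordinatewise. Hence p^α divides |A|.

{-# OPTIONS --safe #-}
module Submission where

open import Defs
open import Data.Nat using (ℕ; NonZero; _*_; _^_; _≤_; _∸_)
open import Data.Nat.Divisibility using (_∣_)
open import Data.Nat.Primality using (Prime)
open import Data.Fin using (Fin)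
open import Data.Fin.Subset using (Subset; _∈_; ∣_∣)
open import Data.Product using (Σ; ∃; ∃-syntax; _×_; _,_)
open import Relation.Nullary using (¬_)
open import Relation.Binary.PropositionalEquality using (_≡_)

open import Data.Nat.Properties
open import Algebra.Properties.CommutativeSemigroup *-commutativeSemigroup using (x∙yz≈y∙xz)
open import Algebra.Properties.Semiring.Sum +-*-semiring
  using (sum; sum-cong-≗; sum-replicate-zero; ∑-distrib-+; *-distribˡ-sum)
open import Data.Bool using (Bool; true; false; _∧_)
import Data.Bool.Properties as Bool
open import Data.Empty using (⊥-elim)
open import Data.Fin as Fin using (toℕ)
import Data.Fin.Properties as Fin
open import Data.Fin.Properties using (toℕ-fromℕ<; toℕ-injective; toℕ<n)
open import Data.Fin.Subset using (⋂; _∩_; _∉_; _⊂_; _⊆_; Nonempty; Empty)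
open import Data.Fin.Subset.Properties
  using (∩-assoc; ∩-idem; ∩-identityˡ; ∩-identityʳ; x∈p∩q⁺; x∈p∩q⁻; p∩q⊆q)
open import Data.List as List using (List; filter; length; upTo; replicate; _++_; [_]; _∷_; [])
open import Data.List.Properties
  using (filter-++; filter-accept; length-++; length-++-≤ˡ; length-replicate; map-++; tabulate-lookup; upTo-∷ʳ)
open import Data.List.Relation.Unary.All as All using (All; _∷_)
open import Data.List.Relation.Unary.All.Properties using (++⁺; replicate⁺; tabulate⁻)
open import Data.Nat using (suc; zero; _+_; _%_; _<_; _≤′_; ≤′-refl; ≤′-step; s≤s; z≤n; nonTrivial⇒n>1)
open import Data.Nat.Coprimality using (Coprime; coprime?; coprime-divisor)
open import Data.Nat.Divisibility
  using ( divides; _∣0; ∣-refl; ∣-trans; ∣1⇒≡1; ∣m∣n⇒∣m+n; ∣m+n∣m⇒∣n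
        ; ∣m⇒∣m*n; ∣n⇒∣m*n; m∣m*n; *-pres-∣)
open import Data.Nat.DivMod using (_/_; _mod_; m≡m%n+[m/n]*n; %-distribˡ-+; %-distribˡ-*; m<n⇒m%n≡m)
open import Data.Nat.Primality using (prime⇒nonTrivial)
open import Data.Nat.Tactic.RingSolver using (solve-∀)
open import Data.Product using (proj₁; proj₂)
open import Data.Sum using (_⊎_; inj₁; inj₂)
import Data.Vec as Vec
open import Data.Vec using (Vec; lookup; zipWith; _∷_; [])
open import Data.Vec.Functional using (updateAt)
open import Data.Vec.Functional.Properties using (updateAt-updates; updateAt-minimal)
open import Data.Vec.Properties
  using ( []=⇒lookup; lookup⇒[]=; lookup∘tabulate; lookup-map; lookup-replicate; lookup-zipWith
        ; tabulate∘lookup; tabulate-cong)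
open import Function using (_∘_)
open import Relation.Binary.PropositionalEquality
  using (_≢_; _≗_; refl; sym; trans; cong; cong₂; subst; module ≡-Reasoning)
open import Relation.Nullary using (yes; no; does)
open import Relation.Nullary.Decidable using (decidable-stable)

𝟙 : Bool → ℕ
𝟙 true  = 1
𝟙 false = 0

[1+y]^n≡1+n*y+y*y*h : ∀ y n → ∃[ h ] ((1 + y) ^ n ≡ 1 + n * y + y * y * h)
[1+y]^n≡1+n*y+y*y*h y zero = 0 , cong suc (sym (*-zeroʳ (y * y)))
[1+y]^n≡1+n*y+y*y*h y (suc n) =
  let h , eq = [1+y]^n≡1+n*y+y*y*h y n in
  h + n + y * h , trans (cong ((1 + y) *_) eq) (expand y n h)
  where
  expand : ∀ y n h → (1 + y) * (1 + n * y + y * y * h) ≡ 1 + suc n * y + y * y * (h + n + y * h)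
  expand = solve-∀

[1+p^[1+s]*c]^p≡1+p^[2+s]*c′ : ∀ p s c → ∃[ c′ ] ((1 + p ^ suc s * c) ^ p ≡ 1 + p ^ suc (suc s) * c′)
[1+p^[1+s]*c]^p≡1+p^[2+s]*c′ p s c =
  let h , eq = [1+y]^n≡1+n*y+y*y*h (p ^ suc s * c) p in
  c + p ^ s * c * c * h , trans eq (regroup p (p ^ s) c h)
  where
  regroup : ∀ p P c h → 1 + p * (p * P * c) + (p * P * c) * (p * P * c) * h ≡ 1 + p * (p * P) * (c + P * c * c * h)
  regroup = solve-∀

[1+p*q]^p^β≡1+p^[1+β]*c : ∀ p q β → ∃[ c ] ((1 + p * q) ^ (p ^ β) ≡ 1 + p ^ suc β * c)
[1+p*q]^p^β≡1+p^[1+β]*c p q zero = q , trans (*-identityʳ _) (cong (λ p′ → 1 + p′ * q) (sym (*-identityʳ p)))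
[1+p*q]^p^β≡1+p^[1+β]*c p q (suc β) =
  let c , eq = [1+p*q]^p^β≡1+p^[1+β]*c p q β
      c′ , eq′ = [1+p^[1+s]*c]^p≡1+p^[2+s]*c′ p β c
  in c′ , (begin
    (1 + p * q) ^ (p * p ^ β)   ≡⟨ cong ((1 + p * q) ^_) (*-comm p (p ^ β)) ⟩
    (1 + p * q) ^ (p ^ β * p)   ≡⟨ sym (^-*-assoc (1 + p * q) (p ^ β) p) ⟩
    ((1 + p * q) ^ (p ^ β)) ^ p ≡⟨ cong (_^ p) eq ⟩
    (1 + p ^ suc β * c) ^ p     ≡⟨ eq′ ⟩
    1 + p ^ suc (suc β) * c′    ∎)
  where open ≡-Reasoning

n<m^n : ∀ m n → 2 ≤ m → n < m ^ n
n<m^n m zero    _   = s≤s z≤n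
n<m^n m (suc n) 2≤m = begin-strict
  suc n         <⟨ m<m+n (suc n) (s≤s z≤n) ⟩
  suc n + suc n ≡⟨ cong (suc n +_) (sym (+-identityʳ (suc n))) ⟩
  2 * suc n     ≤⟨ *-mono-≤ 2≤m (n<m^n m n 2≤m) ⟩
  m * m ^ n     ∎
  where open ≤-Reasoning

^-monoʳ-∣ : ∀ m {a b} → a ≤ b → m ^ a ∣ m ^ b
^-monoʳ-∣ m {a} {b} a≤b = divides (m ^ (b ∸ a))
  (trans (cong (m ^_) (sym (m∸n+n≡m a≤b))) (^-distribˡ-+-* m (b ∸ a) a))

^-monoˡ-∣ : ∀ {d m} e → d ∣ m → d ^ e ∣ m ^ e
^-monoˡ-∣ zero    _   = ∣-refl
^-monoˡ-∣ (suc e) d∣m = *-pres-∣ d∣m (^-monoˡ-∣ e d∣m)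

p^[1+β]∣[p*q]^p^β : ∀ p q β → 2 ≤ p → p ^ suc β ∣ (p * q) ^ (p ^ β)
p^[1+β]∣[p*q]^p^β p q β 2≤p = ∣-trans (^-monoʳ-∣ p (n<m^n p β 2≤p)) (^-monoˡ-∣ (p ^ β) (m∣m*n q))

w%p≡𝟙b⇒w^p^β≡𝟙b+p^[1+β]*c : ∀ p .{{_ : NonZero p}} β w b → 2 ≤ p → w % p ≡ 𝟙 b →
  ∃[ c ] (w ^ (p ^ β) ≡ 𝟙 b + p ^ suc β * c)
w%p≡𝟙b⇒w^p^β≡𝟙b+p^[1+β]*c p β w b 2≤p w%p≡𝟙b = residue b w≡𝟙b+p*q
  where
  q : ℕ
  q = w / p
  w≡𝟙b+p*q : w ≡ 𝟙 b + p * q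
  w≡𝟙b+p*q = trans (m≡m%n+[m/n]*n w p) (cong₂ _+_ w%p≡𝟙b (*-comm q p))
  residue : ∀ b → w ≡ 𝟙 b + p * q → ∃[ c ] (w ^ (p ^ β) ≡ 𝟙 b + p ^ suc β * c)
  residue true  eq = subst (λ v → ∃[ c ] (v ^ (p ^ β) ≡ 1 + p ^ suc β * c)) (sym eq)
    ([1+p*q]^p^β≡1+p^[1+β]*c p q β)
  residue false eq with p^[1+β]∣[p*q]^p^β p q β 2≤p
  ... | divides c eq′ = c , trans (cong (λ v → v ^ (p ^ β)) eq) (trans eq′ (*-comm c (p ^ suc β)))

-- totient m is coprimesUpTo m m by definition.
coprimesUpTo : ℕ → ℕ → ℕ
coprimesUpTo m N = length (filter (λ i → coprime? i m) (List.map suc (upTo N)))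

coprimesUpTo-suc : ∀ m N →
  coprimesUpTo m (suc N) ≡ coprimesUpTo m N + length (filter (λ i → coprime? i m) [ suc N ])
coprimesUpTo-suc m N = begin
  length (filter P? (List.map suc (upTo (suc N))))
    ≡⟨ cong (λ l → length (filter P? (List.map suc l))) (sym (upTo-∷ʳ N)) ⟩
  length (filter P? (List.map suc (upTo N ++ [ N ])))
    ≡⟨ cong (λ l → length (filter P? l)) (map-++ suc (upTo N) [ N ]) ⟩
  length (filter P? (List.map suc (upTo N) ++ [ suc N ]))
    ≡⟨ cong length (filter-++ P? (List.map suc (upTo N)) [ suc N ]) ⟩
  length (filter P? (List.map suc (upTo N)) ++ filter P? [ suc N ])
    ≡⟨ length-++ (filter P? (List.map suc (upTo N))) ⟩
  coprimesUpTo m N + length (filter P? [ suc N ])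
    ∎
  where
  open ≡-Reasoning
  P? = λ i → coprime? i m

coprimesUpTo-monoʳ-≤ : ∀ m {N N′} → N ≤ N′ → coprimesUpTo m N ≤ coprimesUpTo m N′
coprimesUpTo-monoʳ-≤ m N≤N′ = mono (≤⇒≤′ N≤N′)
  where
  mono : ∀ {N N′} → N ≤′ N′ → coprimesUpTo m N ≤ coprimesUpTo m N′
  mono ≤′-refl = ≤-refl
  mono {N} (≤′-step {N′} N≤′N′) = ≤-trans (mono N≤′N′)
    (≤-trans (m≤m+n _ _) (≤-reflexive (sym (coprimesUpTo-suc m N′))))

coprimesUpTo-suc-coprime : ∀ m N → Coprime (suc N) m → coprimesUpTo m (suc N) ≡ suc (coprimesUpTo m N)
coprimesUpTo-suc-coprime m N coprime = begin
  coprimesUpTo m (suc N)                                          ≡⟨ coprimesUpTo-suc m N ⟩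
  coprimesUpTo m N + length (filter (λ i → coprime? i m) [ suc N ])
    ≡⟨ cong (λ l → coprimesUpTo m N + length l) (filter-accept (λ i → coprime? i m) coprime) ⟩
  coprimesUpTo m N + 1                                            ≡⟨ +-comm _ 1 ⟩
  suc (coprimesUpTo m N)                                          ∎
  where open ≡-Reasoning

1+p*q-coprime-p^α : ∀ p q α → Coprime (suc (p * q)) (p ^ α)
1+p*q-coprime-p^α p q zero    (_ , d∣1) = ∣1⇒≡1 d∣1
1+p*q-coprime-p^α p q (suc α) {d} (d∣1+pq , d∣p*p^α) =
  1+p*q-coprime-p^α p q α (d∣1+pq , coprime-divisor d-coprime-p d∣p*p^α)
  where
  d-coprime-p : Coprime d p
  d-coprime-p {e} (e∣d , e∣p) = ∣1⇒≡1 (∣m+n∣m⇒∣n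
    (subst (e ∣_) (+-comm 1 (p * q)) (∣-trans e∣d d∣1+pq)) (∣m⇒∣m*n q e∣p))

q≤coprimesUpTo[p*q] : ∀ p α q → 1 ≤ p → q ≤ coprimesUpTo (p ^ α) (p * q)
q≤coprimesUpTo[p*q] p α zero    _   = z≤n
q≤coprimesUpTo[p*q] p α (suc q) 1≤p = begin
  suc q                                  ≤⟨ s≤s (q≤coprimesUpTo[p*q] p α q 1≤p) ⟩
  suc (coprimesUpTo (p ^ α) (p * q))
    ≡⟨ sym (coprimesUpTo-suc-coprime (p ^ α) (p * q) (1+p*q-coprime-p^α p q α)) ⟩
  coprimesUpTo (p ^ α) (suc (p * q))     ≤⟨ coprimesUpTo-monoʳ-≤ (p ^ α) 1+pq≤p*[1+q] ⟩
  coprimesUpTo (p ^ α) (p * suc q)       ∎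
  where
  open ≤-Reasoning
  1+pq≤p*[1+q] : suc (p * q) ≤ p * suc q
  1+pq≤p*[1+q] = ≤-trans (+-monoˡ-≤ (p * q) 1≤p) (≤-reflexive (sym (*-suc p q)))

p^β≤totient[p^[1+β]] : ∀ p β → 1 ≤ p → p ^ β ≤ totient (p ^ suc β)
p^β≤totient[p^[1+β]] p β = q≤coprimesUpTo[p*q] p (suc β) (p ^ β)

𝟙[_] : ∀ {n} → Subset n → Fin n → ℕ
𝟙[ S ] r = 𝟙 (lookup S r)

∣S∣≡sum𝟙[S] : ∀ {n} (S : Subset n) → ∣ S ∣ ≡ sum 𝟙[ S ]
∣S∣≡sum𝟙[S] []          = refl
∣S∣≡sum𝟙[S] (true ∷ S)  = cong suc (∣S∣≡sum𝟙[S] S)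
∣S∣≡sum𝟙[S] (false ∷ S) = ∣S∣≡sum𝟙[S] S

𝟙[∩] : ∀ {n} (S T : Subset n) r → 𝟙[ S ∩ T ] r ≡ 𝟙[ S ] r * 𝟙[ T ] r
𝟙[∩] S T r rewrite lookup-zipWith _∧_ r S T with lookup S r
... | true  = sym (+-identityʳ _)
... | false = refl

⋂-++ : ∀ {n} (L L′ : List (Subset n)) → ⋂ (L ++ L′) ≡ ⋂ L ∩ ⋂ L′
⋂-++ []      L′ = sym (∩-identityˡ (⋂ L′))
⋂-++ (G ∷ L) L′ = trans (cong (G ∩_) (⋂-++ L L′)) (sym (∩-assoc G (⋂ L) (⋂ L′)))

⋂-replicate-++ : ∀ {n} m (G : Subset n) L → ⋂ (replicate m G ++ G ∷ L) ≡ ⋂ (G ∷ L)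
⋂-replicate-++ zero    G L = refl
⋂-replicate-++ (suc m) G L = begin
  G ∩ ⋂ (replicate m G ++ G ∷ L) ≡⟨ cong (G ∩_) (⋂-replicate-++ m G L) ⟩
  G ∩ (G ∩ ⋂ L)                  ≡⟨ sym (∩-assoc G G (⋂ L)) ⟩
  (G ∩ G) ∩ ⋂ L                  ≡⟨ cong (_∩ ⋂ L) (∩-idem G) ⟩
  G ∩ ⋂ L                        ∎
  where open ≡-Reasoning

lookup≡false⇒∉ : ∀ {n} {F : Subset n} {r} → lookup F r ≡ false → r ∉ F
lookup≡false⇒∉ Fr≡false r∈F with trans (sym Fr≡false) ([]=⇒lookup r∈F)
... | ()

separating⇒splits : ∀ {n} {F B : Subset n} {j r} → j ∈ B → r ∈ B → lookup F j ≢ lookup F r →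
  Nonempty (F ∩ B) × F ∩ B ⊂ B
separating⇒splits {F = F} {B} {j} {r} j∈B r∈B Fj≢Fr with lookup F j in Fj | lookup F r in Fr
... | true  | true  = ⊥-elim (Fj≢Fr refl)
... | false | false = ⊥-elim (Fj≢Fr refl)
... | true  | false = (j , x∈p∩q⁺ (lookup⇒[]= j F Fj , j∈B)) , p∩q⊆q F B , r , r∈B ,
  lookup≡false⇒∉ Fr ∘ proj₁ ∘ x∈p∩q⁻ F B
... | false | true  = (r , x∈p∩q⁺ (lookup⇒[]= r F Fr , r∈B)) , p∩q⊆q F B , j , j∈B ,
  lookup≡false⇒∉ Fj ∘ proj₁ ∘ x∈p∩q⁻ F B

uniform⇒⊆⊎disjoint : ∀ {n} {A G : Subset n} {j} → j ∈ A →
  (∀ {r} → r ∈ A → lookup G r ≡ lookup G j) → A ⊆ G ⊎ Empty (A ∩ G)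
uniform⇒⊆⊎disjoint {A = A} {G} {j} j∈A uniform with lookup G j
... | true  = inj₁ λ {r} r∈A → lookup⇒[]= r G (uniform r∈A)
... | false = inj₂ λ (r , r∈A∩G) → let r∈A , r∈G = x∈p∩q⁻ A G r∈A∩G in
  lookup≡false⇒∉ (uniform r∈A) r∈G

module IndicatorPolynomials {n : ℕ} (ℱ : Family {n}) where

  -- Padding G ∷ L with copies of G reaches exactly k sets without changing the intersection.
  ∣⋂∣-divisible : ∀ {k ℓ L} → KWiseDivisible k ℓ ℱ → All ℱ L → 1 ≤ length L → length L ≤ k →
    ℓ ∣ ∣ ⋂ L ∣
  ∣⋂∣-divisible {k} {ℓ} {G ∷ L} k-wise (ℱG ∷ ℱL) _ |L|≤k =
    subst (ℓ ∣_) (cong ∣_∣ ⋂padded≡⋂L) (k-wise′ (List.lookup padded) (tabulate⁻ ℱpadded))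
    where
    m : ℕ
    m = k ∸ length (G ∷ L)
    padded : List (Subset n)
    padded = replicate m G ++ G ∷ L
    |padded|≡k : length padded ≡ k
    |padded|≡k = trans (length-++ (replicate m G))
      (trans (cong (_+ length (G ∷ L)) (length-replicate m)) (m∸n+n≡m |L|≤k))
    k-wise′ : KWiseDivisible (length padded) ℓ ℱ
    k-wise′ = subst (λ k → KWiseDivisible k ℓ ℱ) (sym |padded|≡k) k-wise
    ℱpadded : All ℱ (List.tabulate (List.lookup padded))
    ℱpadded = subst (All ℱ) (sym (tabulate-lookup padded)) (++⁺ (replicate⁺ m ℱG) (ℱG ∷ ℱL))
    ⋂padded≡⋂L : ⋂ (List.tabulate (List.lookup padded)) ≡ ⋂ (G ∷ L)
    ⋂padded≡⋂L = trans (cong ⋂ (tabulate-lookup padded)) (⋂-replicate-++ m G L)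

  -- Polynomials of degree ≤ d, without constant term, in the indicator functions of members of ℱ.
  infixl 6 _+ᴾ_
  infixl 7 _·ᴾ_ _*ᴾ_

  data Poly (d : ℕ) : (Fin n → ℕ) → Set where
    0ᴾ   : Poly d (λ _ → 0)
    𝟙⋂ᴾ  : ∀ {L} → All ℱ L → 1 ≤ length L → length L ≤ d → Poly d 𝟙[ ⋂ L ]
    _+ᴾ_ : ∀ {W W′} → Poly d W → Poly d W′ → Poly d (λ r → W r + W′ r)
    _·ᴾ_ : ∀ {W} c → Poly d W → Poly d (λ r → c * W r)
    resp : ∀ {W W′} → W ≗ W′ → Poly d W → Poly d W′

  𝟙⋂*ᴾ : ∀ {d d′ L W} → All ℱ L → 1 ≤ length L → length L ≤ d → Poly d′ W →
    Poly (d + d′) (λ r → 𝟙[ ⋂ L ] r * W r)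
  𝟙⋂*ᴾ {L = L} _ _ _ 0ᴾ = resp (λ r → sym (*-zeroʳ (𝟙[ ⋂ L ] r))) 0ᴾ
  𝟙⋂*ᴾ {L = L} ℱL 1≤|L| |L|≤d (𝟙⋂ᴾ {L′} ℱL′ _ |L′|≤d′) =
    resp (λ r → trans (cong (λ S → 𝟙[ S ] r) (⋂-++ L L′)) (𝟙[∩] (⋂ L) (⋂ L′) r))
      (𝟙⋂ᴾ (++⁺ ℱL ℱL′) (≤-trans 1≤|L| (length-++-≤ˡ L))
        (≤-trans (≤-reflexive (length-++ L)) (+-mono-≤ |L|≤d |L′|≤d′)))
  𝟙⋂*ᴾ {L = L} ℱL 1≤|L| |L|≤d (_+ᴾ_ {W} {W′} P Q) =
    resp (λ r → sym (*-distribˡ-+ (𝟙[ ⋂ L ] r) (W r) (W′ r)))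
      (𝟙⋂*ᴾ ℱL 1≤|L| |L|≤d P +ᴾ 𝟙⋂*ᴾ ℱL 1≤|L| |L|≤d Q)
  𝟙⋂*ᴾ {L = L} ℱL 1≤|L| |L|≤d (_·ᴾ_ {W} c P) =
    resp (λ r → x∙yz≈y∙xz c (𝟙[ ⋂ L ] r) (W r)) (c ·ᴾ 𝟙⋂*ᴾ ℱL 1≤|L| |L|≤d P)
  𝟙⋂*ᴾ {L = L} ℱL 1≤|L| |L|≤d (resp W≗W′ P) =
    resp (λ r → cong ((𝟙[ ⋂ L ] r) *_) (W≗W′ r)) (𝟙⋂*ᴾ ℱL 1≤|L| |L|≤d P)

  _*ᴾ_ : ∀ {d d′ W W′} → Poly d W → Poly d′ W′ → Poly (d + d′) (λ r → W r * W′ r)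
  0ᴾ                  *ᴾ Q = 0ᴾ
  𝟙⋂ᴾ ℱL 1≤|L| |L|≤d *ᴾ Q = 𝟙⋂*ᴾ ℱL 1≤|L| |L|≤d Q
  _*ᴾ_ {W′ = V} (_+ᴾ_ {W} {W′} P P′) Q =
    resp (λ r → sym (*-distribʳ-+ (V r) (W r) (W′ r))) ((P *ᴾ Q) +ᴾ (P′ *ᴾ Q))
  _*ᴾ_ {W′ = V} (_·ᴾ_ {W} c P) Q = resp (λ r → sym (*-assoc c (W r) (V r))) (c ·ᴾ (P *ᴾ Q))
  _*ᴾ_ {W′ = V} (resp W≗W′ P) Q = resp (λ r → cong (_* V r) (W≗W′ r)) (P *ᴾ Q)

  _^ᴾ_ : ∀ {d W} → Poly d W → ∀ e .{{_ : NonZero e}} → Poly (e * d) (λ r → W r ^ e)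
  P ^ᴾ 1           = resp (λ r → sym (*-identityʳ _)) (subst (λ d → Poly d _) (sym (+-identityʳ _)) P)
  P ^ᴾ suc (suc e) = P *ᴾ (P ^ᴾ suc e)

  ℓ∣sum-Poly : ∀ {k ℓ d W} → KWiseDivisible k ℓ ℱ → d ≤ k → Poly d W → ℓ ∣ sum W
  ℓ∣sum-Poly {ℓ = ℓ} k-wise d≤k 0ᴾ = subst (ℓ ∣_) (sym (sum-replicate-zero n)) (ℓ ∣0)
  ℓ∣sum-Poly {ℓ = ℓ} k-wise d≤k (𝟙⋂ᴾ {L} ℱL 1≤|L| |L|≤d) =
    subst (ℓ ∣_) (∣S∣≡sum𝟙[S] (⋂ L)) (∣⋂∣-divisible k-wise ℱL 1≤|L| (≤-trans |L|≤d d≤k))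
  ℓ∣sum-Poly {ℓ = ℓ} k-wise d≤k (_+ᴾ_ {W} {W′} P Q) = subst (ℓ ∣_) (sym (∑-distrib-+ W W′))
    (∣m∣n⇒∣m+n (ℓ∣sum-Poly k-wise d≤k P) (ℓ∣sum-Poly k-wise d≤k Q))
  ℓ∣sum-Poly {ℓ = ℓ} k-wise d≤k (_·ᴾ_ {W} c P) =
    subst (ℓ ∣_) (*-distribˡ-sum c W) (∣n⇒∣m*n c (ℓ∣sum-Poly k-wise d≤k P))
  ℓ∣sum-Poly {ℓ = ℓ} k-wise d≤k (resp W≗W′ P) =
    subst (ℓ ∣_) (sum-cong-≗ W≗W′) (ℓ∣sum-Poly k-wise d≤k P)

lookup-ext : ∀ {A : Set} {m} {x y : Vec A m} → (∀ r → lookup x r ≡ lookup y r) → x ≡ y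
lookup-ext {x = x} {y} x≗y = trans (sym (tabulate∘lookup x)) (trans (tabulate-cong x≗y) (tabulate∘lookup y))

-- Only 2 ≤ p (for 0ₚ ≢ 1ₚ) is used here; nothing needs p to be prime.
module Modular (p : ℕ) .{{_ : NonZero p}} (2≤p : 2 ≤ p) where

  infixl 6 _+ₚ_
  infixl 7 _*ₚ_

  _+ₚ_ _*ₚ_ : 𝔽 p → 𝔽 p → 𝔽 p
  _+ₚ_ = _+F_ p
  _*ₚ_ = _*F_ p

  0ₚ 1ₚ : 𝔽 p
  0ₚ = 0F p
  1ₚ = 1F p

  toℕ-mod : ∀ m → toℕ (m mod p) ≡ m % p
  toℕ-mod m = toℕ-fromℕ< _

  mod-toℕ : ∀ a → toℕ a mod p ≡ a
  mod-toℕ a = toℕ-injective (trans (toℕ-mod (toℕ a)) (m<n⇒m%n≡m (toℕ<n a)))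

  mod-+ : ∀ a b → (a + b) mod p ≡ (a mod p) +ₚ (b mod p)
  mod-+ a b = toℕ-injective (begin
    toℕ ((a + b) mod p)                  ≡⟨ toℕ-mod (a + b) ⟩
    (a + b) % p                          ≡⟨ %-distribˡ-+ a b p ⟩
    (a % p + b % p) % p                  ≡⟨ cong₂ (λ x y → (x + y) % p) (sym (toℕ-mod a)) (sym (toℕ-mod b)) ⟩
    (toℕ (a mod p) + toℕ (b mod p)) % p  ≡⟨ sym (toℕ-mod _) ⟩
    toℕ ((a mod p) +ₚ (b mod p))         ∎)
    where open ≡-Reasoning

  mod-* : ∀ a b → (a * b) mod p ≡ (a mod p) *ₚ (b mod p)
  mod-* a b = toℕ-injective (begin
    toℕ ((a * b) mod p)                  ≡⟨ toℕ-mod (a * b) ⟩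
    (a * b) % p                          ≡⟨ %-distribˡ-* a b p ⟩
    (a % p * (b % p)) % p                ≡⟨ cong₂ (λ x y → (x * y) % p) (sym (toℕ-mod a)) (sym (toℕ-mod b)) ⟩
    (toℕ (a mod p) * toℕ (b mod p)) % p  ≡⟨ sym (toℕ-mod _) ⟩
    toℕ ((a mod p) *ₚ (b mod p))         ∎)
    where open ≡-Reasoning

  𝟙b%p≡𝟙b : ∀ b → 𝟙 b % p ≡ 𝟙 b
  𝟙b%p≡𝟙b true  = m<n⇒m%n≡m 2≤p
  𝟙b%p≡𝟙b false = m<n⇒m%n≡m (≤-trans (s≤s z≤n) 2≤p)

  toℕ-𝟙b-mod : ∀ b → toℕ (𝟙 b mod p) ≡ 𝟙 b
  toℕ-𝟙b-mod b = trans (toℕ-mod (𝟙 b)) (𝟙b%p≡𝟙b b)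

  toℕ-𝟙-mod-cong : ∀ {b b′} → 𝟙 b mod p ≡ 𝟙 b′ mod p → 𝟙 b ≡ 𝟙 b′
  toℕ-𝟙-mod-cong {b} {b′} eq = trans (sym (toℕ-𝟙b-mod b)) (trans (cong toℕ eq) (toℕ-𝟙b-mod b′))

  𝟙-mod-injective : ∀ {b b′} → 𝟙 b mod p ≡ 𝟙 b′ mod p → b ≡ b′
  𝟙-mod-injective {true}  {true}  _  = refl
  𝟙-mod-injective {false} {false} _  = refl
  𝟙-mod-injective {true}  {false} eq with toℕ-𝟙-mod-cong eq
  ... | ()
  𝟙-mod-injective {false} {true}  eq with toℕ-𝟙-mod-cong eq
  ... | ()

  0ₚ≢1ₚ : 0ₚ ≢ 1ₚ
  0ₚ≢1ₚ eq with 𝟙-mod-injective {false} {true} eq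
  ... | ()

  +ₚ-identityˡ : ∀ a → 0ₚ +ₚ a ≡ a
  +ₚ-identityˡ a = trans (cong (λ z → (z + toℕ a) mod p) (toℕ-𝟙b-mod false)) (mod-toℕ a)

  +ₚ-identityʳ : ∀ a → a +ₚ 0ₚ ≡ a
  +ₚ-identityʳ a = trans (cong (λ z → (toℕ a + z) mod p) (toℕ-𝟙b-mod false))
    (trans (cong (_mod p) (+-identityʳ (toℕ a))) (mod-toℕ a))

  *ₚ-zeroʳ : ∀ a → a *ₚ 0ₚ ≡ 0ₚ
  *ₚ-zeroʳ a = cong (_mod p) (trans (cong (toℕ a *_) (toℕ-𝟙b-mod false)) (*-zeroʳ (toℕ a)))

  *ₚ-identityʳ : ∀ a → a *ₚ 1ₚ ≡ a
  *ₚ-identityʳ a = trans (cong (λ z → (toℕ a * z) mod p) (toℕ-𝟙b-mod true))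
    (trans (cong (_mod p) (*-identityʳ (toℕ a))) (mod-toℕ a))

  lookup-χ : ∀ {n} (F : Subset n) r → lookup (χ p F) r ≡ 𝟙[ F ] r mod p
  lookup-χ (true ∷ F)  Fin.zero    = refl
  lookup-χ (false ∷ F) Fin.zero    = refl
  lookup-χ (_ ∷ F)     (Fin.suc r) = lookup-χ F r

  infixl 6 _+ᵥ_
  infixl 7 _*ᵥ_ _·ᵥ_

  _+ᵥ_ _*ᵥ_ : ∀ {n} → Vecp p n → Vecp p n → Vecp p n
  _+ᵥ_ = _+V_ p
  _*ᵥ_ = _*V_ p

  _·ᵥ_ : ∀ {n} → 𝔽 p → Vecp p n → Vecp p n
  _·ᵥ_ = _·V_ p

  0ᵥ : ∀ {n} → Vecp p n
  0ᵥ = 0V p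

  Independent : ∀ {n} → Vecp p n → Vecp p n → Set
  Independent x y = ∀ a b → a ·ᵥ x +ᵥ b ·ᵥ y ≡ 0ᵥ → a ≡ 0ₚ × b ≡ 0ₚ

  lookup-lincomb : ∀ {n} a b (x y : Vecp p n) r →
    lookup (a ·ᵥ x +ᵥ b ·ᵥ y) r ≡ a *ₚ lookup x r +ₚ b *ₚ lookup y r
  lookup-lincomb a b x y r =
    trans (lookup-zipWith _+ₚ_ r (a ·ᵥ x) (b ·ᵥ y))
      (cong₂ _+ₚ_ (lookup-map r (a *ₚ_) x) (lookup-map r (b *ₚ_) y))

  independent : ∀ {n} {x y : Vecp p n} {u v} →
    lookup x u ≡ 1ₚ → lookup x v ≡ 1ₚ → lookup y u ≡ 0ₚ → lookup y v ≡ 1ₚ → Independent x y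
  independent {x = x} {y} {u} {v} xu≡1 xv≡1 yu≡0 yv≡1 a b ax+by≡0 = a≡0 , b≡0
    where
    open ≡-Reasoning
    vanishes : ∀ r → a *ₚ lookup x r +ₚ b *ₚ lookup y r ≡ 0ₚ
    vanishes r = trans (sym (lookup-lincomb a b x y r))
      (trans (cong (λ z → lookup z r) ax+by≡0) (lookup-replicate r 0ₚ))
    a≡0 : a ≡ 0ₚ
    a≡0 = begin
      a                                   ≡⟨ sym (+ₚ-identityʳ a) ⟩
      a +ₚ 0ₚ                             ≡⟨ sym (cong₂ _+ₚ_ (*ₚ-identityʳ a) (*ₚ-zeroʳ b)) ⟩
      a *ₚ 1ₚ +ₚ b *ₚ 0ₚ                  ≡⟨ sym (cong₂ _+ₚ_ (cong (a *ₚ_) xu≡1) (cong (b *ₚ_) yu≡0)) ⟩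
      a *ₚ lookup x u +ₚ b *ₚ lookup y u  ≡⟨ vanishes u ⟩
      0ₚ                                  ∎
    b≡0 : b ≡ 0ₚ
    b≡0 = begin
      b                                   ≡⟨ sym (+ₚ-identityˡ b) ⟩
      0ₚ +ₚ b                             ≡⟨ sym (cong₂ _+ₚ_ (*ₚ-identityʳ 0ₚ) (*ₚ-identityʳ b)) ⟩
      0ₚ *ₚ 1ₚ +ₚ b *ₚ 1ₚ                 ≡⟨ sym (cong₂ _+ₚ_ (cong₂ _*ₚ_ a≡0 xv≡1) (cong (b *ₚ_) yv≡1)) ⟩
      a *ₚ lookup x v +ₚ b *ₚ lookup y v  ≡⟨ vanishes v ⟩
      0ₚ                                  ∎

  Span-least : ∀ {n} {G P : Code p n} → IsSubspace p P → (∀ {x} → G x → P x) → ∀ {x} → Span p G x → P x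
  Span-least P-subspace G⊆P span-0           = IsSubspace.has-0 P-subspace
  Span-least P-subspace G⊆P (span-gen x∈G)   = G⊆P x∈G
  Span-least P-subspace G⊆P (span-+ x∈S y∈S) =
    IsSubspace.has-+ P-subspace (Span-least P-subspace G⊆P x∈S) (Span-least P-subspace G⊆P y∈S)
  Span-least P-subspace G⊆P (span-· a x∈S)   = IsSubspace.has-· P-subspace a (Span-least P-subspace G⊆P x∈S)

  powC-induction : ∀ {n} {G : Code p n} (P : ℕ → Code p n) → (∀ i → IsSubspace p (P i)) →
    (∀ {x} → G x → P 0 x) → (∀ {i x y} → P i x → P 0 y → P (suc i) (x *ᵥ y)) →
    ∀ i {x} → powC p (Span p G) i x → P i x
  powC-induction P subspace gen mul zero    = Span-least (subspace 0) gen
  powC-induction P subspace gen mul (suc i) = Span-least (subspace (suc i)) λ where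
    (x , y , x∈ , y∈ , refl) →
      mul (powC-induction P subspace gen mul i x∈) (powC-induction P subspace gen mul 0 y∈)

  idempotent∈powC : ∀ {n} {V : Code p n} {x} → V x → x *ᵥ x ≡ x → ∀ i → powC p V i x
  idempotent∈powC         x∈V x*x≡x zero    = x∈V
  idempotent∈powC {x = x} x∈V x*x≡x (suc i) =
    span-gen (x , x , idempotent∈powC x∈V x*x≡x i , x∈V , sym x*x≡x)

  χ*χ≡χ : ∀ {n} (F : Subset n) → χ p F *ᵥ χ p F ≡ χ p F
  χ*χ≡χ F = lookup-ext λ r → begin
    lookup (χ p F *ᵥ χ p F) r                  ≡⟨ lookup-zipWith _*ₚ_ r (χ p F) (χ p F) ⟩
    lookup (χ p F) r *ₚ lookup (χ p F) r       ≡⟨ cong (λ a → a *ₚ a) (lookup-χ F r) ⟩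
    (𝟙[ F ] r mod p) *ₚ (𝟙[ F ] r mod p)        ≡⟨ idempotent (lookup F r) ⟩
    𝟙[ F ] r mod p                             ≡⟨ sym (lookup-χ F r) ⟩
    lookup (χ p F) r                           ∎
    where
    open ≡-Reasoning
    idempotent : ∀ b → (𝟙 b mod p) *ₚ (𝟙 b mod p) ≡ 𝟙 b mod p
    idempotent true  = *ₚ-identityʳ 1ₚ
    idempotent false = *ₚ-zeroʳ 0ₚ

  lookup-χ-∈ : ∀ {n} {A : Subset n} {r} → r ∈ A → lookup (χ p A) r ≡ 1ₚ
  lookup-χ-∈ {A = A} {r} r∈A = trans (lookup-χ A r) (cong (λ b → 𝟙 b mod p) ([]=⇒lookup r∈A))

  χ-∈supp : ∀ {n} {C : Code p n} {A r} → C (χ p A) → r ∈ A → _∈supp_ p r C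
  χ-∈supp {A = A} χA∈C r∈A =
    χ p A , χA∈C , λ χAr≡0 → 0ₚ≢1ₚ (trans (sym χAr≡0) (lookup-χ-∈ r∈A))

  lookup-sumV-suc : ∀ {n m} (c : Fin (suc m) → Vecp p n) r →
    lookup (sumV p c) r ≡ lookup (c Fin.zero) r +ₚ lookup (sumV p (c ∘ Fin.suc)) r
  lookup-sumV-suc c r = lookup-zipWith _+ₚ_ r (c Fin.zero) (sumV p (c ∘ Fin.suc))

  lookup-sumV-zero : ∀ {n m} (c : Fin m → Vecp p n) r → (∀ i → lookup (c i) r ≡ 0ₚ) →
    lookup (sumV p c) r ≡ 0ₚ
  lookup-sumV-zero {m = zero}  c r c≡0 = lookup-replicate r 0ₚ
  lookup-sumV-zero {m = suc m} c r c≡0 = trans (lookup-sumV-suc c r)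
    (trans (cong₂ _+ₚ_ (c≡0 Fin.zero) (lookup-sumV-zero (c ∘ Fin.suc) r (c≡0 ∘ Fin.suc)))
      (+ₚ-identityʳ 0ₚ))

  lookup-sumV-single : ∀ {n m} (c : Fin m → Vecp p n) i r →
    (∀ i′ → i′ ≢ i → lookup (c i′) r ≡ 0ₚ) → lookup (sumV p c) r ≡ lookup (c i) r
  lookup-sumV-single c Fin.zero r others≡0 = trans (lookup-sumV-suc c r)
    (trans (cong (lookup (c Fin.zero) r +ₚ_) (lookup-sumV-zero (c ∘ Fin.suc) r λ i → others≡0 (Fin.suc i) λ ()))
      (+ₚ-identityʳ _))
  lookup-sumV-single c (Fin.suc i) r others≡0 = trans (lookup-sumV-suc c r)
    (trans (cong₂ _+ₚ_ (others≡0 Fin.zero λ ())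
             (lookup-sumV-single (c ∘ Fin.suc) i r λ i′ i′≢i →
               others≡0 (Fin.suc i′) (i′≢i ∘ Fin.suc-injective)))
      (+ₚ-identityˡ _))

  01-vector⇒χ : ∀ {n} (y : Vecp p n) → (∀ r → lookup y r ≢ 0ₚ → lookup y r ≡ 1ₚ) →
    ∃[ A ] (y ≡ χ p A)
  01-vector⇒χ y y01 = A , lookup-ext λ r → trans (y≡𝟙[A] r) (sym (lookup-χ A r))
    where
    A : Subset _
    A = Vec.tabulate (λ r → does (lookup y r Fin.≟ 1ₚ))
    y≡𝟙[A] : ∀ r → lookup y r ≡ 𝟙[ A ] r mod p
    y≡𝟙[A] r rewrite lookup∘tabulate (λ r → does (lookup y r Fin.≟ 1ₚ)) r with lookup y r Fin.≟ 1ₚ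
    ... | yes yr≡1 = yr≡1
    ... | no  yr≢1 = decidable-stable (lookup y r Fin.≟ 0ₚ) (yr≢1 ∘ y01 r)

  dim≤1⇒constant-on : ∀ {n} {D : Code p n} {A G : Subset n} {y} → ¬ DimGe2 p D → D (χ p A) → D y →
    (∀ {s} → s ∈ A → lookup y s ≡ lookup (χ p G) s) →
    ∀ {r r′} → r ∈ A → r′ ∈ A → lookup G r ≡ lookup G r′
  dim≤1⇒constant-on {A = A} {G} {y} dim≤1 χA∈D y∈D y≗χG {r} {r′} r∈A r′∈A =
    decidable-stable (lookup G r Bool.≟ lookup G r′) λ Gr≢Gr′ →
      dim≤1 (χ p A , y , χA∈D , y∈D , separated Gr≢Gr′)
    where
    y-at : ∀ {s b} → s ∈ A → lookup G s ≡ b → lookup y s ≡ 𝟙 b mod p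
    y-at {s} s∈A Gs≡b = trans (y≗χG s∈A) (trans (lookup-χ G s) (cong (λ b → 𝟙 b mod p) Gs≡b))
    separated : lookup G r ≢ lookup G r′ → Independent (χ p A) y
    separated Gr≢Gr′ with lookup G r in Gr | lookup G r′ in Gr′
    ... | true  | true  = ⊥-elim (Gr≢Gr′ refl)
    ... | false | false = ⊥-elim (Gr≢Gr′ refl)
    ... | true  | false = independent (lookup-χ-∈ r′∈A) (lookup-χ-∈ r∈A) (y-at r′∈A Gr′) (y-at r∈A Gr)
    ... | false | true  = independent (lookup-χ-∈ r∈A) (lookup-χ-∈ r′∈A) (y-at r∈A Gr) (y-at r′∈A Gr′)

  module _ {n} (S : Set) (j r : Fin n) where

    AgreeOr : Code p n
    AgreeOr x = lookup x j ≡ lookup x r ⊎ S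

    AgreeOr-zipWith : ∀ (f : 𝔽 p → 𝔽 p → 𝔽 p) {x y} → AgreeOr x → AgreeOr y → AgreeOr (zipWith f x y)
    AgreeOr-zipWith f {x} {y} (inj₁ xj≡xr) (inj₁ yj≡yr) =
      inj₁ (trans (lookup-zipWith f j x y) (trans (cong₂ f xj≡xr yj≡yr) (sym (lookup-zipWith f r x y))))
    AgreeOr-zipWith f (inj₁ _) (inj₂ s) = inj₂ s
    AgreeOr-zipWith f (inj₂ s) _        = inj₂ s

    AgreeOr-subspace : IsSubspace p AgreeOr
    AgreeOr-subspace = record
      { has-0 = inj₁ (trans (lookup-replicate j 0ₚ) (sym (lookup-replicate r 0ₚ)))
      ; has-+ = λ {x} {y} → AgreeOr-zipWith _+ₚ_ {x} {y}
      ; has-· = λ {x} → has-· {x}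
      }
      where
      has-· : ∀ {x} a → AgreeOr x → AgreeOr (a ·ᵥ x)
      has-· {x} a (inj₁ xj≡xr) =
        inj₁ (trans (lookup-map j (a *ₚ_) x) (trans (cong (a *ₚ_) xj≡xr) (sym (lookup-map r (a *ₚ_) x))))
      has-· a (inj₂ s) = inj₂ s

  module Generated {n} (ℱ : Family {n}) where
    open IndicatorPolynomials ℱ

    V : Code p n
    V = Span p (λ x → ∃[ F ] (ℱ F × x ≡ χ p F))

    χ∈V^⟨i⟩ : ∀ i {F} → ℱ F → powC p V i (χ p F)
    χ∈V^⟨i⟩ i {F} ℱF = idempotent∈powC (span-gen (F , ℱF , refl)) (χ*χ≡χ F) i

    Separating : Fin n → Fin n → Set
    Separating j r = ∃[ F ] (ℱ F × lookup F j ≢ lookup F r)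

    agree-or-separating : ∀ i j r {x} → powC p V i x → AgreeOr (Separating j r) j r x
    agree-or-separating i j r = powC-induction (λ _ → AgreeOr (Separating j r) j r)
      (λ _ → AgreeOr-subspace (Separating j r) j r) χF-agrees
      (λ {_} {x} {y} → AgreeOr-zipWith (Separating j r) j r _*ₚ_ {x} {y}) i
      where
      χF-agrees : ∀ {x} → ∃[ F ] (ℱ F × x ≡ χ p F) → AgreeOr (Separating j r) j r x
      χF-agrees (F , ℱF , refl) with lookup F j Bool.≟ lookup F r
      ... | yes Fj≡Fr =
        inj₁ (trans (lookup-χ F j) (trans (cong (λ b → 𝟙 b mod p) Fj≡Fr) (sym (lookup-χ F r))))
      ... | no  Fj≢Fr = inj₂ (F , ℱF , Fj≢Fr)

    χ∈V^⟨i⟩⇒maximal : ∀ i {A B j} → powC p V i (χ p A) → j ∈ A → A ⊂ B →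
      ∃[ F ] (ℱ F × Nonempty (F ∩ B) × F ∩ B ⊂ B)
    χ∈V^⟨i⟩⇒maximal i {A} {B} {j} χA∈ j∈A (A⊆B , r , r∈B , r∉A) with agree-or-separating i j r χA∈
    ... | inj₁ χAj≡χAr = ⊥-elim (r∉A (lookup⇒[]= r A (sym (𝟙-mod-injective Aj≡Ar))))
      where
      Aj≡Ar : 𝟙 true mod p ≡ 𝟙[ A ] r mod p
      Aj≡Ar = trans (sym (lookup-χ-∈ j∈A)) (trans χAj≡χAr (lookup-χ A r))
    ... | inj₂ (F , ℱF , Fj≢Fr) = F , ℱF , separating⇒splits (A⊆B j∈A) r∈B Fj≢Fr

    -- Scalars act through their representatives in ℕ, so lifts never need negative values.
    Lifts : Vecp p n → (Fin n → ℕ) → Set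
    Lifts x W = ∀ r → W r mod p ≡ lookup x r

    LiftsTo : ℕ → Code p n
    LiftsTo d x = ∃[ W ] (Poly d W × Lifts x W)

    LiftsTo-subspace : ∀ d → IsSubspace p (LiftsTo d)
    LiftsTo-subspace d = record
      { has-0 = (λ _ → 0) , 0ᴾ , λ r → sym (lookup-replicate r 0ₚ)
      ; has-+ = λ { {x} {y} (W , P , W↦x) (W′ , P′ , W′↦y) → (λ r → W r + W′ r) , P +ᴾ P′ , λ r →
                  trans (mod-+ (W r) (W′ r))
                    (trans (cong₂ _+ₚ_ (W↦x r) (W′↦y r)) (sym (lookup-zipWith _+ₚ_ r x y))) }
      ; has-· = λ { {x} a (W , P , W↦x) → (λ r → toℕ a * W r) , toℕ a ·ᴾ P , λ r →
                  trans (mod-* (toℕ a) (W r))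
                    (trans (cong₂ _*ₚ_ (mod-toℕ a) (W↦x r)) (sym (lookup-map r (a *ₚ_) x))) }
      }

    LiftsTo-* : ∀ {d d′ x y} → LiftsTo d x → LiftsTo d′ y → LiftsTo (d + d′) (x *ᵥ y)
    LiftsTo-* {x = x} {y} (W , P , W↦x) (W′ , P′ , W′↦y) = (λ r → W r * W′ r) , P *ᴾ P′ , λ r →
      trans (mod-* (W r) (W′ r)) (trans (cong₂ _*ₚ_ (W↦x r) (W′↦y r)) (sym (lookup-zipWith _*ₚ_ r x y)))

    V^⟨1+i⟩-lifts : ∀ i {x} → powC p V i x → LiftsTo (suc i) x
    V^⟨1+i⟩-lifts = powC-induction (λ i → LiftsTo (suc i)) (λ i → LiftsTo-subspace (suc i)) χF-lifts
      λ {i} {x} {y} x↑ y↑ →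
        subst (λ d → LiftsTo d (x *ᵥ y)) (+-comm (suc i) 1) (LiftsTo-* {x = x} {y} x↑ y↑)
      where
      χF-lifts : ∀ {x} → ∃[ F ] (ℱ F × x ≡ χ p F) → LiftsTo 1 x
      χF-lifts (F , ℱF , refl) = 𝟙[ ⋂ (F ∷ []) ] , 𝟙⋂ᴾ (ℱF ∷ All.[]) ≤-refl ≤-refl , λ r →
        trans (cong (λ S → 𝟙[ S ] r mod p) (∩-identityʳ F)) (sym (lookup-χ F r))

    lift-of-χ⇒p^[1+β]∣∣A∣ : ∀ β {d k ℓ A W} → KWiseDivisible k ℓ ℱ → p ^ suc β ∣ ℓ →
      p ^ β * d ≤ k → Poly d W → Lifts (χ p A) W → p ^ suc β ∣ ∣ A ∣
    lift-of-χ⇒p^[1+β]∣∣A∣ β {ℓ = ℓ} {A} {W} k-wise p^[1+β]∣ℓ degree≤k P W↦χA =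
      ∣m+n∣m⇒∣n (subst (p ^ suc β ∣_) ∑W^p^β≡ (∣-trans p^[1+β]∣ℓ ℓ∣∑W^p^β)) (m∣m*n (sum c))
      where
      instance
        p^β≢0 : NonZero (p ^ β)
        p^β≢0 = m^n≢0 p β
      ℓ∣∑W^p^β : ℓ ∣ sum (λ r → W r ^ p ^ β)
      ℓ∣∑W^p^β = ℓ∣sum-Poly k-wise degree≤k (P ^ᴾ (p ^ β))
      W%p≡𝟙[A] : ∀ r → W r % p ≡ 𝟙[ A ] r
      W%p≡𝟙[A] r = begin
        W r % p                  ≡⟨ sym (toℕ-mod (W r)) ⟩
        toℕ (W r mod p)          ≡⟨ cong toℕ (trans (W↦χA r) (lookup-χ A r)) ⟩
        toℕ (𝟙[ A ] r mod p)     ≡⟨ toℕ-𝟙b-mod (lookup A r) ⟩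
        𝟙[ A ] r                 ∎
        where open ≡-Reasoning
      residue : ∀ r → ∃[ c ] (W r ^ p ^ β ≡ 𝟙[ A ] r + p ^ suc β * c)
      residue r = w%p≡𝟙b⇒w^p^β≡𝟙b+p^[1+β]*c p β (W r) (lookup A r) 2≤p (W%p≡𝟙[A] r)
      c : Fin n → ℕ
      c r = proj₁ (residue r)
      ∑W^p^β≡ : sum (λ r → W r ^ p ^ β) ≡ p ^ suc β * sum c + ∣ A ∣
      ∑W^p^β≡ = begin
        sum (λ r → W r ^ p ^ β)                    ≡⟨ sum-cong-≗ (proj₂ ∘ residue) ⟩
        sum (λ r → 𝟙[ A ] r + p ^ suc β * c r)     ≡⟨ ∑-distrib-+ 𝟙[ A ] (λ r → p ^ suc β * c r) ⟩
        sum 𝟙[ A ] + sum (λ r → p ^ suc β * c r)   ≡⟨ cong₂ _+_ (sym (∣S∣≡sum𝟙[S] A))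
                                                                   (sym (*-distribˡ-sum (p ^ suc β) c)) ⟩
        ∣ A ∣ + p ^ suc β * sum c                  ≡⟨ +-comm ∣ A ∣ _ ⟩
        p ^ suc β * sum c + ∣ A ∣                  ∎
        where open ≡-Reasoning

    χ∈V^⟨t⟩⇒p^α∣∣A∣ : ∀ β T {k ℓ A} → KWiseDivisible k ℓ ℱ → p ^ suc β ∣ ℓ →
      suc T * totient (p ^ suc β) ≤ k → powC p V T (χ p A) → p ^ suc β ∣ ∣ A ∣
    χ∈V^⟨t⟩⇒p^α∣∣A∣ β T {k} {A = A} k-wise p^[1+β]∣ℓ t*φ≤k χA∈ =
      let W , P , W↦χA = V^⟨1+i⟩-lifts T χA∈
      in lift-of-χ⇒p^[1+β]∣∣A∣ β {A = A} k-wise p^[1+β]∣ℓ degree≤k P W↦χA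
      where
      1≤p : 1 ≤ p
      1≤p = ≤-trans (s≤s z≤n) 2≤p
      degree≤k : p ^ β * suc T ≤ k
      degree≤k = begin
        p ^ β * suc T                   ≤⟨ *-monoˡ-≤ (suc T) (p^β≤totient[p^[1+β]] p β 1≤p) ⟩
        totient (p ^ suc β) * suc T     ≡⟨ *-comm (totient (p ^ suc β)) (suc T) ⟩
        suc T * totient (p ^ suc β)     ≤⟨ t*φ≤k ⟩
        k                               ∎
        where open ≤-Reasoning

  module Decomposition {n m} {W : Code p n} {C : Fin m → Code p n} (decomp : IsSuppDecomp p W m C) where
    open IsSuppDecomp decomp

    lookup-sumV-on-supp : ∀ c → (∀ i → C i (c i)) → ∀ {r i} → _∈supp_ p r (C i) →
      lookup (sumV p c) r ≡ lookup (c i) r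
    lookup-sumV-on-supp c c∈C {r} {i} r∈suppCi = lookup-sumV-single c i r λ i′ i′≢i →
      decidable-stable (lookup (c i′) r Fin.≟ 0ₚ) λ c[i′]r≢0 →
        i′≢i (disjoint i′ i r (c i′ , c∈C i′ , c[i′]r≢0) r∈suppCi)

    component : ∀ {w} → W w → ∀ i → ∃[ y ] (C i y × (∀ {r} → _∈supp_ p r (C i) → lookup y r ≡ lookup w r))
    component {w} w∈W i =
      let c , c∈C , w≡∑c = sum-eq w w∈W
      in c i , c∈C i , λ {r} r∈suppCi →
        trans (sym (lookup-sumV-on-supp c c∈C r∈suppCi)) (cong (λ v → lookup v r) (sym w≡∑c))

    summand⊆sum : ∀ {i x} → C i x → W x
    summand⊆sum {i} {x} x∈Ci =
      subst W (lookup-ext λ r → trans (lookup-sumV-single single i r off) single-at-i) (sum-in single single∈C)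
      where
      single : Fin m → Vecp p n
      single = updateAt (λ _ → 0ᵥ) i (λ _ → x)
      single-at-i : ∀ {r} → lookup (single i) r ≡ lookup x r
      single-at-i {r} = cong (λ v → lookup v r) (updateAt-updates i (λ _ → 0ᵥ))
      off : ∀ {r} i′ → i′ ≢ i → lookup (single i′) r ≡ 0ₚ
      off {r} i′ i′≢i =
        trans (cong (λ v → lookup v r) (updateAt-minimal i′ i (λ _ → 0ᵥ) i′≢i)) (lookup-replicate r 0ₚ)
      single∈C : ∀ i′ → C i′ (single i′)
      single∈C i′ with i′ Fin.≟ i
      ... | yes refl = subst (C i) (sym (updateAt-updates i (λ _ → 0ᵥ))) x∈Ci
      ... | no i′≢i  =
        subst (C i′) (sym (updateAt-minimal i′ i (λ _ → 0ᵥ) i′≢i)) (IsSubspace.has-0 (subspace i′))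

    χ-component : ∀ {G i j} → W (χ p G) → _∈supp_ p j (C i) → j ∈ G → ∃[ A ] (C i (χ p A) × j ∈ A)
    χ-component {G} {i} {j} χG∈W j∈suppCi j∈G =
      let y , y∈Ci , y≗χG = component χG∈W i
          y≡𝟙[G] : ∀ {r} → _∈supp_ p r (C i) → lookup y r ≡ 𝟙[ G ] r mod p
          y≡𝟙[G] {r} r∈supp = trans (y≗χG r∈supp) (lookup-χ G r)
          A , y≡χA = 01-vector⇒χ y λ r yr≢0 → nonzero-bit (y≡𝟙[G] (y , y∈Ci , yr≢0)) yr≢0
          Aj≡true : 𝟙[ A ] j mod p ≡ 𝟙 true mod p
          Aj≡true = trans (sym (lookup-χ A j)) (trans (cong (λ v → lookup v j) (sym y≡χA))
                      (trans (y≡𝟙[G] j∈suppCi) (cong (λ b → 𝟙 b mod p) ([]=⇒lookup j∈G))))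
      in A , subst (C i) y≡χA y∈Ci , lookup⇒[]= j A (𝟙-mod-injective Aj≡true)
      where
      nonzero-bit : ∀ {a b} → a ≡ 𝟙 b mod p → a ≢ 0ₚ → a ≡ 1ₚ
      nonzero-bit {b = true}  a≡1 _   = a≡1
      nonzero-bit {b = false} a≡0 a≢0 = ⊥-elim (a≢0 a≡0)

    constant-on-χ-component : ∀ {i A G} → ¬ DimGe2 p (C i) → C i (χ p A) → W (χ p G) →
      ∀ {r r′} → r ∈ A → r′ ∈ A → lookup G r ≡ lookup G r′
    constant-on-χ-component {i} {G = G} dim≤1 χA∈Ci χG∈W =
      let y , y∈Ci , y≗χG = component χG∈W i
      in dim≤1⇒constant-on {G = G} dim≤1 χA∈Ci y∈Ci (y≗χG ∘ χ-∈supp χA∈Ci)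

lemma4p9 : (t α p : ℕ) .{{_ : NonZero p}} → Prime p → 1 ≤ t → 1 ≤ α →
    (n k ℓ : ℕ) (ℱ : Family {n}) → 1 ≤ k → 1 ≤ ℓ →
    FullSupport ℱ → KWiseDivisible k ℓ ℱ →
    (p ^ α) ∣ ℓ → t * totient (p ^ α) ≤ k →
    let V : Code p n
        V = Span p (λ x → ∃[ F ] (ℱ F × x ≡ χ p F))
    in (m : ℕ) (C : Fin m → Code p n) → IsIndecDecomp p (_^⟨_⟩ p V t) m C →
    (j : Fin n) → ¬ (∃[ i ] (DimGe2 p (C i) × _∈supp_ p j (C i))) →
    ∃[ A ] (IsAtom ℱ A × j ∈ A × (p ^ α) ∣ ∣ A ∣)
-- With t = suc T, V ^⟨ t ⟩ is powC V T by definition.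
lemma4p9 (suc T) (suc β) p p-prime _ _ n k ℓ ℱ _ _ full k-wise p^α∣ℓ t*φ≤k m C indecomposition j j∉S =
  let F , ℱF , j∈F    = full j
      i , j∈suppCi    = covers j
      A , χA∈Ci , j∈A = χ-component (χ∈V^⟨i⟩ T ℱF) j∈suppCi j∈F
      χA∈V^⟨t⟩         = summand⊆sum χA∈Ci
      dim≤1 : ¬ DimGe2 p (C i)
      dim≤1 dim≥2 = j∉S (i , dim≥2 , j∈suppCi)
      ⊆-or-disjoint : ∀ G → ℱ G → A ⊆ G ⊎ Empty (A ∩ G)
      ⊆-or-disjoint G ℱG = uniform⇒⊆⊎disjoint j∈A λ r∈A →
        constant-on-χ-component dim≤1 χA∈Ci (χ∈V^⟨i⟩ T ℱG) r∈A j∈A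
      maximal : ∀ B → A ⊂ B → ∃[ F ] (ℱ F × Nonempty (F ∩ B) × F ∩ B ⊂ B)
      maximal B = χ∈V^⟨i⟩⇒maximal T χA∈V^⟨t⟩ j∈A
  in A , ((j , j∈A) , ⊆-or-disjoint , maximal) , j∈A ,
     χ∈V^⟨t⟩⇒p^α∣∣A∣ β T k-wise p^α∣ℓ t*φ≤k χA∈V^⟨t⟩
  where
  open Modular p (nonTrivial⇒n>1 p {{prime⇒nonTrivial p-prime}})
  open Generated ℱ
  open IsIndecDecomp indecomposition
  open Decomposition decomp
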